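{- Let $F$ be a digraph having a $2$-source $x$. Then $\mathrm{mad}_{\vec{\chi}}(F)\le 2\,\mathrm{mad}_{\vec{\chi}}(F-x)-1$.
   Context: Digraphs are finite. A $k$-source in a digraph is a vertex with in-degree $0$ and out-degree at most $k$. $\vec{\chi}(D)$ is the least $k$ such that $V(D)$ can be partitioned into $k$ sets each inducing an acyclic subdigraph. A subdivision of $F$ is obtained by replacing each arc $(u,v)$ by a directed $(u,v)$-path of length at least 1, internally disjoint; $D$ contains a subdivision of $F$ if some subdigraph of $D$ is one. $\mathrm{mad}_{\vec{\chi}}(F)$ is the least integer $c$ such that every digraph $D$ with $\vec{\chi}(D)\ge c$ contains a subdivision of $F$ (this exists for every digraph). -}

module Defs where

open import Data.Nat using (ℕ; zero; suc; _≤_; _<_; _*_; _∸_)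
open import Data.Fin using (Fin; zero; suc; toℕ; inject₁; fromℕ; punchIn)
open import Data.Bool using (Bool; true; false)
open import Data.Fin.Subset using (∣_∣)
open import Data.Vec using (tabulate)
open import Data.Product using (Σ; _×_; ∃)
open import Relation.Binary.PropositionalEquality using (_≡_; _≢_)
open import Relation.Nullary using (¬_)
open import Function.Definitions using (Injective)

-- A (finite, loopless) digraph on vertex set Fin size; arc u v = true iff (u,v) is an arc.
-- No parallel arcs; opposite arcs (digons) are allowed.
record Digraph : Set where
  field
    size     : ℕ
    arc      : Fin size → Fin size → Bool
    loopless : ∀ v → arc v v ≡ false
open Digraph public

Vertex : Digraph → Set
Vertex D = Fin (size D)

Arc : (D : Digraph) → Vertex D → Vertex D → Set
Arc D u v = arc D u v ≡ true

record Path (D : Digraph) (s t : Vertex D) : Set where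
  field
    len      : ℕ
    vert     : Fin (suc len) → Vertex D
    distinct : Injective _≡_ _≡_ vert
    start    : vert zero ≡ s
    end      : vert (fromℕ len) ≡ t
    step     : (i : Fin len) → Arc D (vert (inject₁ i)) (vert (suc i))
open Path public

Interior : {D : Digraph} {s t : Vertex D} → Path D s t → Vertex D → Set
Interior P w = ∃ λ i → (0 < toℕ i) × (toℕ i < len P) × (vert P i ≡ w)

record Cycle (D : Digraph) : Set where
  field
    first last : Vertex D
    path       : Path D first last
    nontrivial : 1 ≤ len path
    close      : Arc D last first
open Cycle public

InducesAcyclic : (D : Digraph) → (Vertex D → Set) → Set
InducesAcyclic D S = ¬ (Σ (Cycle D) λ C → ∀ i → S (vert (path C) i))

AcyclicColouring : Digraph → ℕ → Set
AcyclicColouring D k =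
  Σ (Vertex D → Fin k) λ col → ∀ (j : Fin k) → InducesAcyclic D (λ v → col v ≡ j)

-- dichromatic number of D is at least c  (χ⃗(D) = least k with an acyclic k-colouring)
DichromaticAtLeast : Digraph → ℕ → Set
DichromaticAtLeast D c = ∀ k → AcyclicColouring D k → c ≤ k

record ContainsSubdivision (D F : Digraph) : Set where
  field
    branch       : Vertex F → Vertex D
    branch-inj   : Injective _≡_ _≡_ branch
    path         : ∀ u v → Arc F u v → Path D (branch u) (branch v)
    path-len     : ∀ u v (a : Arc F u v) → 1 ≤ len (path u v a)
    avoid-branch : ∀ u v (a : Arc F u v) w → Interior (path u v a) w → ∀ z → branch z ≢ w
    int-disjoint : ∀ u v (a : Arc F u v) u' v' (a' : Arc F u' v') w →
                   Interior (path u v a) w → Interior (path u' v' a') w →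
                   (u ≡ u') × (v ≡ v')

MadBound : Digraph → ℕ → Set
MadBound F c = ∀ D → DichromaticAtLeast D c → ContainsSubdivision D F

IsMad : Digraph → ℕ → Set
IsMad F m = MadBound F m × (∀ c → MadBound F c → m ≤ c)

private
  del : (n : ℕ) (a : Fin n → Fin n → Bool) → (∀ v → a v v ≡ false) → Fin n → Digraph
  del (suc m) a l x = record
    { size = m
    ; arc = λ i j → a (punchIn x i) (punchIn x j)
    ; loopless = λ i → l (punchIn x i) }

_−_ : (F : Digraph) → Vertex F → Digraph
F − x = del (size F) (arc F) (loopless F) x

TwoSource : (F : Digraph) → Vertex F → Set
TwoSource F x = (∀ v → arc F v x ≡ false) × (∣ tabulate (arc F x) ∣ ≤ 2)

-- Let m = mad(F − x) and suppose χ⃗(D) ≥ 2m − 1. Pick a vertex u and split the vertices reachable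
-- from u into breadth-first levels. An arc raises the level by at most one, so a cycle all of whose
-- levels have the same parity lies inside a single level. Hence acyclic (m − 1)-colourings of the
-- levels, with one palette for even and one for odd levels, give a (2m − 2)-colouring of the
-- reachable part; since no arc leaves the reachable part, the remaining vertices are coloured
-- recursively. As χ⃗(D) ≥ 2m − 1 this must fail, so some level L has χ⃗ ≥ m and contains a
-- subdivision of F − x, and L ≠ {u}. Let w be the lowest common ancestor, in the breadth-first
-- tree, of the branch vertices of the (at most two) out-neighbours of x. The tree paths from w to
-- them run through earlier levels, have disjoint interiors by the choice of w, and w ∉ L; they
-- extend the subdivision of F − x to one of F with branch vertex w for x.

module Submission where

open import Defs
open import Level using (0ℓ)
open import Data.Bool as Bool using (Bool; true; false; not; if_then_else_)
open import Data.Bool.Properties using (not-¬)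
open import Data.Empty using (⊥; ⊥-elim)
open import Data.Unit using (⊤; tt)
open import Data.Fin as Fin
  using (Fin; zero; suc; toℕ; inject₁; inject≤; fromℕ; punchIn; punchOut; join; splitAt)
open import Data.Fin.Properties as Finₚ
  using (any?; all?; injective⇒≤; ≤fromℕ; toℕ-fromℕ; toℕ-inject₁; toℕ<n; toℕ-injective;
         inject≤-injective; splitAt-join)
open import Data.Fin.Induction using (<-weakInduction-startingFrom; <-weakInduction)
open import Data.Fin.Subset as Subset using (Subset; ∣_∣; _-_)
open import Data.Fin.Subset.Properties using (x∈p∧x≢y⇒x∈p-y; x∈p⇒∣p-x∣<∣p∣)
open import Data.List using (List; []; _∷_; filter; length; lookup; allFin)
open import Data.List.Membership.Propositional using (_∈_)
open import Data.List.Membership.Propositional.Properties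
  using (∈-filter⁺; ∈-filter⁻; ∈-lookup; ∈-allFin)
open import Data.List.Relation.Unary.All as All using ()
open import Data.List.Relation.Unary.AllPairs using (_∷_)
open import Data.List.Relation.Unary.Any using (index) renaming (tail to ∈-tail)
open import Data.List.Relation.Unary.Any.Properties using (lookup-index; ¬Any[])
open import Data.List.Relation.Unary.Unique.Propositional using (Unique)
open import Data.List.Relation.Unary.Unique.Propositional.Properties as Unique using (allFin⁺)
open import Data.Nat
  using (ℕ; zero; suc; pred; _+_; _*_; _∸_; _≤_; _<_; z≤n; s≤s; s≤s⁻¹; s<s⁻¹; _≤?_; _<?_)
open import Data.Nat.Properties
open import Data.Product using (Σ; ∃; _×_; _,_; proj₁; proj₂)
open import Data.Sum using (_⊎_; inj₁; inj₂; [_,_]′) renaming (map to ⊎-map)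
open import Data.Vec using (tabulate)
open import Data.Vec.Functional as Vector using ()
open import Data.Vec.Properties using (lookup⇒[]=; lookup∘tabulate)
open import Function using (_∘_)
open import Function.Definitions using (Injective)
open import Relation.Binary.PropositionalEquality
  using (_≡_; _≢_; refl; sym; trans; cong; subst; subst₂)
open import Relation.Nullary using (¬_; Dec; yes; no; does)
open import Relation.Nullary.Decidable using (toSum; map′; _×-dec_; _⊎-dec_; _→-dec_; ¬?)
open import Relation.Unary using (Pred; Decidable)

-- The least i < b with P i, or b if there is none.
firstBelow : {P : Pred ℕ 0ℓ} → Decidable P → ℕ → ℕ
firstBelow P? zero = zero
firstBelow P? (suc b) with P? zero
... | yes _ = zero
... | no _ = suc (firstBelow (P? ∘ suc) b)

firstBelow-≤-witness : {P : Pred ℕ 0ℓ} (P? : Decidable P) (b : ℕ) {i : ℕ} → P i → firstBelow P? b ≤ i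
firstBelow-≤-witness P? zero p = z≤n
firstBelow-≤-witness P? (suc b) {i} p with P? zero | i
... | yes _ | _ = z≤n
... | no ¬p₀ | zero = ⊥-elim (¬p₀ p)
... | no _ | suc i = s≤s (firstBelow-≤-witness (P? ∘ suc) b p)

firstBelow-holds : {P : Pred ℕ 0ℓ} (P? : Decidable P) (b : ℕ) {i : ℕ} → P i → i < b →
                   P (firstBelow P? b)
firstBelow-holds P? (suc b) {i} p i<b with P? zero | i
... | yes p₀ | _ = p₀
... | no ¬p₀ | zero = ⊥-elim (¬p₀ p)
... | no _ | suc i = firstBelow-holds (P? ∘ suc) b p (s<s⁻¹ i<b)

firstBelow-minimal : {P : Pred ℕ 0ℓ} (P? : Decidable P) (b : ℕ) {j : ℕ} → j < firstBelow P? b → ¬ P j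
firstBelow-minimal P? (suc b) {j} j<first with P? zero | j
firstBelow-minimal P? (suc b) () | yes _ | _
... | no ¬p₀ | zero = ¬p₀
... | no _ | suc j = firstBelow-minimal (P? ∘ suc) b (s<s⁻¹ j<first)

collectBelow : {A : ℕ → Set} {X : Set} → (∀ ℓ → A ℓ ⊎ X) →
               ∀ b → (∀ ℓ → ℓ < b → A ℓ) ⊎ X
collectBelow f zero = inj₁ λ _ ()
collectBelow f (suc b) with collectBelow f b | f b
... | inj₂ x | _ = inj₂ x
... | inj₁ _ | inj₂ x = inj₂ x
... | inj₁ below | inj₁ a =
  inj₁ λ ℓ ℓ<1+b → [ below ℓ , (λ { refl → a }) ]′ (m<1+n⇒m<n∨m≡n ℓ<1+b)

anyFunction? : ∀ {a b} {P : Pred (Fin a → Fin b) 0ℓ} →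
               (∀ {f g} → (∀ i → f i ≡ g i) → P f → P g) → Decidable P → Dec (∃ P)
anyFunction? {zero} resp P? = map′ (λ p → _ , p) (λ (f , p) → resp (λ ()) p) (P? λ ())
anyFunction? {suc a} resp P? =
  map′ (λ (c , f , p) → c Vector.∷ f , p) (λ (f , p) → f zero , f ∘ suc , resp η p)
       (any? λ c → anyFunction? (λ eq → resp (cons-cong eq)) (P? ∘ (c Vector.∷_)))
  where
  η : ∀ {f : Fin (suc a) → _} i → f i ≡ (f zero Vector.∷ f ∘ suc) i
  η zero = refl
  η (suc i) = refl
  cons-cong : ∀ {c} {f g : Fin a → _} → (∀ i → f i ≡ g i) →
              ∀ i → (c Vector.∷ f) i ≡ (c Vector.∷ g) i
  cons-cong eq zero = refl
  cons-cong eq (suc i) = eq i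

lookup-injective : {A : Set} {xs : List A} → Unique xs → Injective _≡_ _≡_ (lookup xs)
lookup-injective {xs = x ∷ xs} (_ ∷ unique) {zero} {zero} _ = refl
lookup-injective {xs = x ∷ xs} (x∉xs ∷ _) {zero} {suc j} eq = ⊥-elim (All.lookup x∉xs (∈-lookup j) eq)
lookup-injective {xs = x ∷ xs} (x∉xs ∷ _) {suc i} {zero} eq =
  ⊥-elim (All.lookup x∉xs (∈-lookup i) (sym eq))
lookup-injective {xs = x ∷ xs} (_ ∷ unique) {suc i} {suc j} eq = cong suc (lookup-injective unique eq)

true≢false : true ≢ false
true≢false ()

arc? : (D : Digraph) (u v : Vertex D) → Dec (Arc D u v)
arc? D u v = arc D u v Bool.≟ true

module _ {D : Digraph} where

  closingArc : (C : Cycle D) → Arc D (vert (path C) (fromℕ (len (path C)))) (vert (path C) zero)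
  closingArc C = subst₂ (Arc D) (sym (end (path C))) (sym (start (path C))) (close C)

  interior≢start : {s t : Vertex D} (P : Path D s t) {w : Vertex D} → Interior P w → w ≢ s
  interior≢start P (i , 0<i , _ , refl) eq =
    <⇒≢ 0<i (sym (cong toℕ (distinct P (trans eq (sym (start P))))))

  CycleIn : Pred (Vertex D) 0ℓ → Set
  CycleIn X = Σ (Cycle D) λ C → ∀ i → X (vert (path C) i)

  around-cycle : (C : Cycle D) (P Q : Pred (Vertex D) 0ℓ) → (∀ i → P (vert (path C) i)) →
                 (∀ {a b} → P a → P b → Arc D a b → Q a → Q b) →
                 ∀ {s} → Q (vert (path C) s) → ∀ t → Q (vert (path C) t)
  around-cycle C P Q onC closed {s} q = <-weakInduction (Q ∘ v) atZero forward
    where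
    v : Fin (suc (len (path C))) → Vertex D
    v = vert (path C)
    forward : ∀ i → Q (v (inject₁ i)) → Q (v (suc i))
    forward i = closed (onC _) (onC _) (step (path C) i)
    atZero : Q (v zero)
    atZero = closed (onC _) (onC zero) (closingArc C)
               (<-weakInduction-startingFrom (Q ∘ v) q forward (≤fromℕ s))

  IsCycleIn : Pred (Vertex D) 0ℓ → (L : ℕ) → Pred (Fin (suc L) → Vertex D) 0ℓ
  IsCycleIn X L v = 1 ≤ L × Injective _≡_ _≡_ v × (∀ i → Arc D (v (inject₁ i)) (v (suc i))) ×
                    Arc D (v (fromℕ L)) (v zero) × (∀ i → X (v i))

  isCycleIn? : {X : Pred (Vertex D) 0ℓ} → Decidable X → ∀ L → Decidable (IsCycleIn X L)
  isCycleIn? X? L v =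
    1 ≤? L ×-dec injective? ×-dec all? (λ i → arc? D _ _) ×-dec arc? D _ _ ×-dec all? (X? ∘ v)
    where
    injective? : Dec (Injective _≡_ _≡_ v)
    injective? = map′ (λ h {i} {j} → h i j) (λ h i j → h)
                      (all? λ i → all? λ j → (v i Fin.≟ v j) →-dec (i Fin.≟ j))

  isCycleIn-resp : ∀ {X L} {v w : Fin (suc L) → Vertex D} → (∀ i → v i ≡ w i) →
                   IsCycleIn X L v → IsCycleIn X L w
  isCycleIn-resp {X} eq (1≤L , inj , steps , cl , inX) =
    1≤L , (λ e → inj (trans (eq _) (trans e (sym (eq _))))) ,
    (λ i → subst₂ (Arc D) (eq _) (eq _) (steps i)) , subst₂ (Arc D) (eq _) (eq _) cl ,
    (λ i → subst X (eq i) (inX i))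

  -- A cycle has fewer than size D arcs, so it suffices to search finitely many vertex sequences.
  cycleIn? : {X : Pred (Vertex D) 0ℓ} → Decidable X → Dec (CycleIn X)
  cycleIn? {X} X? = map′ toCycle fromCycle
    (anyUpTo? (λ L → anyFunction? (isCycleIn-resp {X}) (isCycleIn? X? L)) (size D))
    where
    toCycle : (∃ λ L → L < size D × ∃ (IsCycleIn X L)) → CycleIn X
    toCycle (L , _ , v , 1≤L , inj , steps , cl , inX) =
      record { first = v zero ; last = v (fromℕ L) ; nontrivial = 1≤L ; close = cl
             ; path = record { len = L ; vert = v ; distinct = inj ; start = refl ; end = refl
                             ; step = steps } }
      , inX
    fromCycle : CycleIn X → ∃ λ L → L < size D × ∃ (IsCycleIn X L)
    fromCycle (C , inX) = len (path C) , injective⇒≤ (distinct (path C)) , vert (path C) ,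
                          nontrivial C , distinct (path C) , step (path C) , closingArc C , inX

  acyclicColouring? : ∀ k → Dec (AcyclicColouring D k)
  acyclicColouring? k = anyFunction? classes-resp λ c → all? λ j → ¬? (cycleIn? λ v → c v Fin.≟ j)
    where
    classes-resp : ∀ {c c′ : Vertex D → Fin k} → (∀ v → c v ≡ c′ v) →
                   (∀ j → InducesAcyclic D (λ v → c v ≡ j)) →
                   ∀ j → InducesAcyclic D (λ v → c′ v ≡ j)
    classes-resp eq acyclic j (C , h) = acyclic j (C , λ t → trans (eq _) (h t))

¬colourable⇒dichromaticAtLeast : ∀ {D k} → ¬ AcyclicColouring D k → DichromaticAtLeast D (suc k)
¬colourable⇒dichromaticAtLeast {D} {k} ¬colourable k′ (c , acyclic) with suc k ≤? k′
... | yes k<k′ = k<k′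
... | no k≮k′ = ⊥-elim (¬colourable (c′ , acyclic′))
  where
  k′≤k : k′ ≤ k
  k′≤k = ≮⇒≥ k≮k′
  c′ : Vertex D → Fin k
  c′ v = inject≤ (c v) k′≤k
  acyclic′ : ∀ j → InducesAcyclic D (λ v → c′ v ≡ j)
  acyclic′ j (C , h) = acyclic (c (vert (path C) zero))
    (C , λ t → inject≤-injective k′≤k k′≤k _ _ (trans (h t) (sym (h zero))))

SetColouring : (D : Digraph) → Pred (Vertex D) 0ℓ → ℕ → Set
SetColouring D X k = Σ (Vertex D → Fin k) λ c → ∀ j → InducesAcyclic D (λ v → X v × c v ≡ j)

SetColouring⊤⇒AcyclicColouring : ∀ {D k} → SetColouring D (λ _ → ⊤) k → AcyclicColouring D k
SetColouring⊤⇒AcyclicColouring (c , acyclic) = c , λ j (C , h) → acyclic j (C , λ t → tt , h t)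

module _ {D : Digraph} where

  atMostOne-colouring : ∀ {X k} → (∀ {v w} → X v → X w → v ≡ w) → SetColouring D X (suc k)
  atMostOne-colouring same = (λ _ → zero) , λ j (C , h) →
    <⇒≢ (nontrivial C) (sym (trans (sym (toℕ-fromℕ _))
                                   (cong toℕ (distinct (path C) (same (proj₁ (h _)) (proj₁ (h zero)))))))

  colouring-closedUnion : ∀ {S R : Pred (Vertex D) 0ℓ} {k} → Decidable R →
                          (∀ {v w} → R v → S w → Arc D v w → R w) →
                          SetColouring D R k → SetColouring D (λ v → S v × ¬ R v) k → SetColouring D S k
  colouring-closedUnion {S} {R} {k} R? closed (cR , acyclicR) (cU , acyclicU) = c , noCycle
    where
    c : Vertex D → Fin k
    c v = if does (R? v) then cR v else cU v
    c-R : ∀ {v} → R v → c v ≡ cR v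
    c-R {v} r with R? v
    ... | yes _ = refl
    ... | no ¬r = ⊥-elim (¬r r)
    c-U : ∀ {v} → ¬ R v → c v ≡ cU v
    c-U {v} ¬r with R? v
    ... | yes r = ⊥-elim (¬r r)
    ... | no _ = refl
    spread : ∀ {j} (C : Cycle D) → (∀ t → S (vert (path C) t) × c (vert (path C) t) ≡ j) →
             ∀ {s} → R (vert (path C) s) → ∀ t → R (vert (path C) t)
    spread {j} C h = around-cycle C (λ x → S x × c x ≡ j) R h (λ _ (sb , _) ab ra → closed ra sb ab)
    noCycle : ∀ j → InducesAcyclic D (λ v → S v × c v ≡ j)
    noCycle j (C , h) with R? (vert (path C) zero)
    ... | yes r₀ = acyclicR j (C , λ t → inR t , trans (sym (c-R (inR t))) (proj₂ (h t)))
      where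
      inR : ∀ t → R (vert (path C) t)
      inR = spread C h r₀
    ... | no ¬r₀ = acyclicU j (C , λ t → (proj₁ (h t) , notR t) , trans (sym (c-U (notR t))) (proj₂ (h t)))
      where
      notR : ∀ t → ¬ R (vert (path C) t)
      notR t r = ¬r₀ (spread C h r zero)

parity : ℕ → Bool
parity zero = false
parity (suc n) = not (parity n)

tagged : {A : Set} → Bool → A → A ⊎ A
tagged true = inj₁
tagged false = inj₂

tagged-injective : {A : Set} {b b′ : Bool} {x x′ : A} →
                   tagged b x ≡ tagged b′ x′ → b ≡ b′ × x ≡ x′
tagged-injective {b = true} {true} refl = refl , refl
tagged-injective {b = false} {false} refl = refl , refl

module _ {D : Digraph} {R : Pred (Vertex D) 0ℓ} {k : ℕ} (level : Vertex D → ℕ)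
         (level-arc : ∀ {v w} → R v → R w → Arc D v w → level w ≤ suc (level v)) where

  layeredColouring : (∀ ℓ → SetColouring D (λ v → R v × level v ≡ ℓ) k) → SetColouring D R (k + k)
  layeredColouring layer = c , noCycle
    where
    inner : Vertex D → Fin k
    inner v = proj₁ (layer (level v)) v
    c : Vertex D → Fin (k + k)
    c v = join k k (tagged (parity (level v)) (inner v))
    c-injective : ∀ {v w} → c v ≡ c w → parity (level v) ≡ parity (level w) × inner v ≡ inner w
    c-injective eq =
      tagged-injective (trans (sym (splitAt-join k k _)) (trans (cong (splitAt k) eq) (splitAt-join k k _)))
    level-nonincreasing : ∀ {v w} → R v → R w → Arc D v w → c v ≡ c w → level w ≤ level v
    level-nonincreasing rv rw a eq with m≤n⇒m<n∨m≡n (level-arc rv rw a)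
    ... | inj₁ lt = s≤s⁻¹ lt
    ... | inj₂ up = ⊥-elim (not-¬ refl (trans (proj₁ (c-injective eq)) (cong parity up)))
    noCycle : ∀ J → InducesAcyclic D (λ v → R v × c v ≡ J)
    noCycle J (C , h) =
      proj₂ (layer ℓ₀) (inner (v zero)) (C , λ t → (proj₁ (h t) , level-constant t) , inner-constant t)
      where
      v : Fin (suc (len (path C))) → Vertex D
      v = vert (path C)
      ℓ₀ : ℕ
      ℓ₀ = level (v zero)
      below : ∀ s t → level (v t) ≤ level (v s)
      below s = around-cycle C (λ x → R x × c x ≡ J) (λ x → level x ≤ level (v s)) h
        (λ (ra , ca) (rb , cb) ab q → ≤-trans (level-nonincreasing ra rb ab (trans ca (sym cb))) q) ≤-refl
      level-constant : ∀ t → level (v t) ≡ ℓ₀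
      level-constant t = ≤-antisym (below zero t) (below t zero)
      inner-constant : ∀ t → proj₁ (layer ℓ₀) (v t) ≡ inner (v zero)
      inner-constant t = subst (λ ℓ → proj₁ (layer ℓ) (v t) ≡ inner (v zero)) (level-constant t)
                               (proj₂ (c-injective (trans (proj₂ (h t)) (sym (proj₂ (h zero))))))

Induced : (D : Digraph) {s : ℕ} → (Fin s → Vertex D) → Digraph
Induced D {s} e = record { size = s ; arc = λ i j → arc D (e i) (e j) ; loopless = λ i → loopless D (e i) }

module CS = ContainsSubdivision

record SubdivisionIn (D F : Digraph) (X : Pred (Vertex D) 0ℓ) : Set where
  field
    subdivision : ContainsSubdivision D F
    branch-in : ∀ z → X (CS.branch subdivision z)
    path-in : ∀ u v (a : Arc F u v) t → X (vert (CS.path subdivision u v a) t)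

module _ {D : Digraph} {s : ℕ} {e : Fin s → Vertex D} (e-injective : Injective _≡_ _≡_ e) where

  liftPath : ∀ {a b} → Path (Induced D e) a b → Path D (e a) (e b)
  liftPath P = record { len = len P ; vert = e ∘ vert P ; distinct = distinct P ∘ e-injective
                      ; start = cong e (start P) ; end = cong e (end P) ; step = step P }

  liftSubdivision : ∀ {F X} → (∀ i → X (e i)) → ContainsSubdivision (Induced D e) F → SubdivisionIn D F X
  liftSubdivision {F} e∈X σ = record { subdivision = σ′ ; branch-in = e∈X ∘ CS.branch σ
                                     ; path-in = λ u v a → e∈X ∘ vert (CS.path σ u v a) }
    where
    σ′ : ContainsSubdivision D F
    σ′ = record
      { branch = e ∘ CS.branch σ
      ; branch-inj = CS.branch-inj σ ∘ e-injective
      ; path = λ u v a → liftPath (CS.path σ u v a)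
      ; path-len = CS.path-len σ
      ; avoid-branch = λ { u v a _ (i , p , q , refl) z eq →
          CS.avoid-branch σ u v a _ (i , p , q , refl) z (e-injective eq) }
      ; int-disjoint = λ { u v a u′ v′ a′ _ (i , p , q , refl) (i′ , p′ , q′ , eq′) →
          CS.int-disjoint σ u v a u′ v′ a′ _ (i , p , q , refl) (i′ , p′ , q′ , e-injective eq′) }
      }

  pullCycle : (C : Cycle D) (f : Fin (suc (len (path C))) → Fin s) →
              (∀ t → e (f t) ≡ vert (path C) t) → Cycle (Induced D e)
  pullCycle C f ef = record
    { first = f zero ; last = f (fromℕ (len (path C))) ; nontrivial = nontrivial C
    ; close = subst₂ (Arc D) (sym (ef _)) (sym (ef zero)) (closingArc C)
    ; path = record
      { len = len (path C) ; vert = f ; start = refl ; end = refl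
      ; distinct = λ {a} {b} eq → distinct (path C) (trans (sym (ef a)) (trans (cong e eq) (ef b)))
      ; step = λ i → subst₂ (Arc D) (sym (ef _)) (sym (ef _)) (step (path C) i) } }

module Enumeration {D : Digraph} {X : Pred (Vertex D) 0ℓ} (X? : Decidable X) where
  open import Data.List.Membership.DecPropositional (Fin._≟_ {size D}) using (_∈?_)

  members : List (Vertex D)
  members = filter X? (allFin (size D))

  element : Fin (length members) → Vertex D
  element = lookup members

  element-injective : Injective _≡_ _≡_ element
  element-injective = lookup-injective (Unique.filter⁺ X? (allFin⁺ (size D)))

  element-∈ : ∀ i → X (element i)
  element-∈ i = proj₂ (∈-filter⁻ X? {xs = allFin (size D)} (∈-lookup i))

  member : ∀ {v} → X v → v ∈ members
  member = ∈-filter⁺ X? (∈-allFin _)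

  subdivisionFromInduced : ∀ {F} → ContainsSubdivision (Induced D element) F → SubdivisionIn D F X
  subdivisionFromInduced = liftSubdivision element-injective element-∈

  colouringFromInduced : ∀ {k} → AcyclicColouring (Induced D element) (suc k) → SetColouring D X (suc k)
  colouringFromInduced {k} (col , acyclic) = c , noMonochromaticCycle
    where
    c : Vertex D → Fin (suc k)
    c v with v ∈? members
    ... | yes v∈ = col (index v∈)
    ... | no _ = zero
    c-element : ∀ i → c (element i) ≡ col i
    c-element i with element i ∈? members
    ... | yes v∈ = cong col (element-injective (sym (lookup-index v∈)))
    ... | no v∉ = ⊥-elim (v∉ (∈-lookup i))
    noMonochromaticCycle : ∀ j → InducesAcyclic D (λ v → X v × c v ≡ j)
    noMonochromaticCycle j (C , h) = acyclic j (pullCycle element-injective C f ef , col-f)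
      where
      f : Fin (suc (len (path C))) → Fin (length members)
      f t = index (member (proj₁ (h t)))
      ef : ∀ t → element (f t) ≡ vert (path C) t
      ef t = sym (lookup-index (member (proj₁ (h t))))
      col-f : ∀ t → col (f t) ≡ j
      col-f t = trans (sym (c-element (f t))) (trans (cong c (ef t)) (proj₂ (h t)))

module Ancestry {D : Digraph} (R : Pred (Vertex D) 0ℓ) (level : Vertex D → ℕ) (root : Vertex D)
  (level-zero : ∀ {v} → R v → level v ≡ 0 → v ≡ root) (parent : Vertex D → Vertex D)
  (parent-step : ∀ {v k} → R v → level v ≡ suc k →
                 R (parent v) × level (parent v) ≡ k × Arc D (parent v) v) where

  ancestor : ℕ → Vertex D → Vertex D
  ancestor zero v = v
  ancestor (suc j) v = parent (ancestor j v)

  ancestor-level : ∀ {v} j → R v → j ≤ level v → R (ancestor j v) × level (ancestor j v) ≡ level v ∸ j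
  ancestor-level zero r _ = r , refl
  ancestor-level (suc j) r j<l with ancestor-level j r (<⇒≤ j<l)
  ... | r′ , l′ with parent-step r′ (trans l′ (+-∸-assoc 1 j<l))
  ...   | r″ , l″ , _ = r″ , l″

  ancestor-arc : ∀ {v} j → R v → suc j ≤ level v → Arc D (ancestor (suc j) v) (ancestor j v)
  ancestor-arc j r j<l with ancestor-level j r (<⇒≤ j<l)
  ... | r′ , l′ = proj₂ (proj₂ (parent-step r′ (trans l′ (+-∸-assoc 1 j<l))))

  ancestor-injective : ∀ {v i j} → R v → i ≤ level v → j ≤ level v →
                       ancestor i v ≡ ancestor j v → i ≡ j
  ancestor-injective r i≤ j≤ eq = ∸-cancelˡ-≡ i≤ j≤
    (trans (sym (proj₂ (ancestor-level _ r i≤))) (trans (cong level eq) (proj₂ (ancestor-level _ r j≤))))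

  level<size : ∀ {v} → R v → level v < size D
  level<size {v} r = injective⇒≤ {f = λ (t : Fin (suc (level v))) → ancestor (toℕ t) v}
    λ eq → toℕ-injective (ancestor-injective r (s≤s⁻¹ (toℕ<n _)) (s≤s⁻¹ (toℕ<n _)) eq)

  treePath : ∀ {v w} k → R v → k ≤ level v → ancestor k v ≡ w → Path D w v
  treePath {v} k r k≤l eq = record
    { len = k ; vert = λ t → ancestor (k ∸ toℕ t) v ; start = eq
    ; end = cong (λ j → ancestor j v) (trans (cong (k ∸_) (toℕ-fromℕ k)) (n∸n≡0 k))
    ; distinct = λ {s} {t} e → toℕ-injective (∸-cancelˡ-≡ (s≤s⁻¹ (toℕ<n s)) (s≤s⁻¹ (toℕ<n t))
                                  (ancestor-injective r (below (toℕ s)) (below (toℕ t)) e))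
    ; step = steps }
    where
    below : ∀ j → k ∸ j ≤ level v
    below j = ≤-trans (m∸n≤m k j) k≤l
    steps : ∀ (t : Fin k) → Arc D (ancestor (k ∸ toℕ (inject₁ t)) v) (ancestor (k ∸ suc (toℕ t)) v)
    steps t = subst (λ j → Arc D (ancestor j v) (ancestor (k ∸ suc (toℕ t)) v))
                    (sym (trans (cong (k ∸_) (toℕ-inject₁ t)) k∸t))
                    (ancestor-arc _ r (subst (_≤ level v) k∸t (below (toℕ t))))
      where
      k∸t : k ∸ toℕ t ≡ suc (k ∸ suc (toℕ t))
      k∸t = +-∸-assoc 1 (toℕ<n t)

  treePath-interior : ∀ {v w x} k (r : R v) (k≤l : k ≤ level v) (eq : ancestor k v ≡ w) →
                      Interior (treePath k r k≤l eq) x → ∃ λ j → 0 < j × j < k × ancestor j v ≡ x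
  treePath-interior k _ _ _ (t , 0<t , t<k , e) =
    k ∸ toℕ t , m<n⇒0<n∸m t<k , ∸-monoʳ-< 0<t (<⇒≤ t<k) , e

  module CommonAncestor {b₁ b₂ : Vertex D} {i : ℕ} (r₁ : R b₁) (r₂ : R b₂)
                        (l₁ : level b₁ ≡ suc i) (l₂ : level b₂ ≡ suc i) where

    OneOf : Pred (Vertex D) 0ℓ
    OneOf b = b ≡ b₁ ⊎ b ≡ b₂

    reached : ∀ {b} → OneOf b → R b
    reached (inj₁ refl) = r₁
    reached (inj₂ refl) = r₂

    level-top : ∀ {b} → OneOf b → level b ≡ suc i
    level-top (inj₁ refl) = l₁
    level-top (inj₂ refl) = l₂

    ancestor-level-top : ∀ {b j} → OneOf b → j ≤ suc i → level (ancestor j b) ≡ suc i ∸ j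
    ancestor-level-top {b} {j} ob j≤ =
      trans (proj₂ (ancestor-level j (reached ob) (subst (j ≤_) (sym (level-top ob)) j≤)))
            (cong (_∸ j) (level-top ob))

    atRoot : ∀ {b} → OneOf b → ancestor (suc i) b ≡ root
    atRoot ob = level-zero (proj₁ (ancestor-level _ (reached ob) (≤-reflexive (sym (level-top ob)))))
                           (trans (ancestor-level-top ob ≤-refl) (n∸n≡0 (suc i)))

    meets? : Decidable (λ j → ancestor (suc j) b₁ ≡ ancestor (suc j) b₂)
    meets? j = ancestor (suc j) b₁ Fin.≟ ancestor (suc j) b₂

    meets-at-root : ancestor (suc i) b₁ ≡ ancestor (suc i) b₂
    meets-at-root = trans (atRoot (inj₁ refl)) (sym (atRoot (inj₂ refl)))

    depth : ℕ
    depth = suc (firstBelow meets? (suc i))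

    depth≤ : depth ≤ suc i
    depth≤ = s≤s (firstBelow-≤-witness meets? (suc i) meets-at-root)

    <depth⇒≤top : ∀ {j} → j < depth → j ≤ suc i
    <depth⇒≤top j< = <⇒≤ (<-≤-trans j< depth≤)

    meet : Vertex D
    meet = ancestor depth b₁

    toMeet : ∀ {b} → OneOf b → ancestor depth b ≡ meet
    toMeet (inj₁ refl) = refl
    toMeet (inj₂ refl) = sym (firstBelow-holds meets? (suc i) meets-at-root ≤-refl)

    below-top : ∀ {b j} → OneOf b → 0 < j → j ≤ suc i → level (ancestor j b) < suc i
    below-top ob 0<j j≤ = subst (_< suc i) (sym (ancestor-level-top ob j≤)) (∸-monoʳ-< 0<j j≤)

    meet-level : level meet < suc i
    meet-level = below-top (inj₁ refl) (s≤s z≤n) depth≤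

    apart : ∀ {j} → 0 < j → j < depth → ancestor j b₁ ≢ ancestor j b₂
    apart {suc j} _ (s≤s j<depth) = firstBelow-minimal meets? (suc i) j<depth

    same-depth : ∀ {b b′ j j′} → OneOf b → OneOf b′ → j < depth → j′ < depth →
                 ancestor j b ≡ ancestor j′ b′ → j ≡ j′
    same-depth ob ob′ j< j′< eq = ∸-cancelˡ-≡ (<depth⇒≤top j<) (<depth⇒≤top j′<)
      (trans (sym (ancestor-level-top ob (<depth⇒≤top j<)))
             (trans (cong level eq) (ancestor-level-top ob′ (<depth⇒≤top j′<))))

    crossing : ∀ {b b′ j j′} → OneOf b → OneOf b′ → 0 < j → j < depth → j′ < depth →
               ancestor j b ≡ ancestor j′ b′ → b ≡ b′
    crossing (inj₁ refl) (inj₁ refl) _ _ _ _ = refl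
    crossing (inj₂ refl) (inj₂ refl) _ _ _ _ = refl
    crossing ob@(inj₁ refl) ob′@(inj₂ refl) 0<j j< j′< eq = ⊥-elim (apart 0<j j<
      (trans eq (cong (λ n → ancestor n b₂) (sym (same-depth ob ob′ j< j′< eq)))))
    crossing ob@(inj₂ refl) ob′@(inj₁ refl) 0<j j< j′< eq = ⊥-elim (apart 0<j j<
      (sym (trans eq (cong (λ n → ancestor n b₁) (sym (same-depth ob ob′ j< j′< eq))))))

    depth≤level : ∀ {b} → OneOf b → depth ≤ level b
    depth≤level ob = subst (depth ≤_) (sym (level-top ob)) depth≤

    pathTo : ∀ {b} → OneOf b → Path D meet b
    pathTo ob = treePath depth (reached ob) (depth≤level ob) (toMeet ob)

    pathTo-interior : ∀ {b x} (ob : OneOf b) → Interior (pathTo ob) x →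
                      ∃ λ j → 0 < j × j < depth × ancestor j b ≡ x
    pathTo-interior ob = treePath-interior depth (reached ob) (depth≤level ob) (toMeet ob)

    pathTo-interior-level : ∀ {b x} (ob : OneOf b) → Interior (pathTo ob) x → level x < suc i
    pathTo-interior-level ob int with pathTo-interior ob int
    ... | j , 0<j , j< , refl = below-top ob 0<j (<depth⇒≤top j<)

    pathTo-disjoint : ∀ {b b′ x} (ob : OneOf b) (ob′ : OneOf b′) →
                      Interior (pathTo ob) x → Interior (pathTo ob′) x → b ≡ b′
    pathTo-disjoint ob ob′ int int′ with pathTo-interior ob int | pathTo-interior ob′ int′
    ... | j , 0<j , j< , e | j′ , _ , j′< , e′ = crossing ob ob′ 0<j j< j′< (trans e (sym e′))

module BreadthFirst {D : Digraph} {S : Pred (Vertex D) 0ℓ} (S? : Decidable S)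
                    (root : Vertex D) (S-root : S root) where

  Within : ℕ → Pred (Vertex D) 0ℓ
  Within zero v = v ≡ root
  Within (suc i) v = Within i v ⊎ (S v × ∃ λ p → Within i p × Arc D p v)

  within? : ∀ i → Decidable (Within i)
  within? zero v = v Fin.≟ root
  within? (suc i) v = within? i v ⊎-dec (S? v ×-dec any? λ p → within? i p ×-dec arc? D p v)

  Within-mono : ∀ {i j v} → i ≤ j → Within i v → Within j v
  Within-mono {j = zero} z≤n w = w
  Within-mono {j = suc j} i≤ w with m≤n⇒m<n∨m≡n i≤
  ... | inj₁ i<1+j = inj₁ (Within-mono (s≤s⁻¹ i<1+j) w)
  ... | inj₂ refl = w

  Within⊆S : ∀ {i v} → Within i v → S v
  Within⊆S {zero} refl = S-root
  Within⊆S {suc i} (inj₁ w) = Within⊆S w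
  Within⊆S {suc i} (inj₂ (s , _)) = s

  Reached : Pred (Vertex D) 0ℓ
  Reached = Within (size D)

  reached? : Decidable Reached
  reached? = within? (size D)

  root-reached : Reached root
  root-reached = Within-mono z≤n refl

  level : Vertex D → ℕ
  level v = firstBelow (λ i → within? i v) (suc (size D))

  level-≤ : ∀ {i v} → Within i v → level v ≤ i
  level-≤ {v = v} = firstBelow-≤-witness (λ i → within? i v) (suc (size D))

  Within-level : ∀ {v} → Reached v → Within (level v) v
  Within-level {v} r = firstBelow-holds (λ i → within? i v) (suc (size D)) r ≤-refl

  level-arc : ∀ {v w} → Reached v → S w → Arc D v w → level w ≤ suc (level v)
  level-arc r s a = level-≤ (inj₂ (s , _ , Within-level r , a))

  level-zero : ∀ {v} → Reached v → level v ≡ 0 → v ≡ root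
  level-zero r eq = subst (λ i → Within i _) eq (Within-level r)

  parentIn : ℕ → Vertex D → Vertex D
  parentIn i v with any? (λ p → within? i p ×-dec arc? D p v)
  ... | yes (p , _) = p
  ... | no _ = v

  parentIn-spec : ∀ {i p v} → Within i p → Arc D p v → Within i (parentIn i v) × Arc D (parentIn i v) v
  parentIn-spec {i} {p} {v} w a with any? (λ p → within? i p ×-dec arc? D p v)
  ... | yes (_ , spec) = spec
  ... | no none = ⊥-elim (none (p , w , a))

  parent : Vertex D → Vertex D
  parent v = parentIn (pred (level v)) v

  parent-step : ∀ {v k} → Reached v → level v ≡ suc k →
                Reached (parent v) × level (parent v) ≡ k × Arc D (parent v) v
  parent-step {v} {k} r eq with subst (λ i → Within i v) eq (Within-level r)
  ... | inj₁ w =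
    ⊥-elim (firstBelow-minimal (λ i → within? i v) (suc (size D)) (subst (k <_) (sym eq) ≤-refl) w)
  ... | inj₂ (_ , p , w , a) =
    subst (λ q → Reached q × level q ≡ k × Arc D q v) (cong (λ l → parentIn (pred l) v) (sym eq))
          (Within-mono k≤size w′ , ≤-antisym (level-≤ w′) k≤level , a′)
    where
    w′ : Within k (parentIn k v)
    w′ = proj₁ (parentIn-spec w a)
    a′ : Arc D (parentIn k v) v
    a′ = proj₂ (parentIn-spec w a)
    k≤size : k ≤ size D
    k≤size = ≤-trans (n≤1+n k) (subst (_≤ size D) eq (level-≤ r))
    k≤level : k ≤ level (parentIn k v)
    k≤level = s≤s⁻¹ (subst (_≤ suc (level (parentIn k v))) eq
                (level-arc (Within-mono k≤size w′) (Within⊆S (Within-level r)) a′))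

  open Ancestry {D} Reached level root level-zero parent parent-step public

  closed : ∀ {v w} → Reached v → S w → Arc D v w → Reached w
  closed r s a = Within-mono (level<size r) (inj₂ (s , _ , Within-level r , a))

  Layer : ℕ → Pred (Vertex D) 0ℓ
  Layer ℓ v = Reached v × level v ≡ ℓ

  layer? : ∀ ℓ → Decidable (Layer ℓ)
  layer? ℓ v = reached? v ×-dec (level v ≟ ℓ)

addSource : (F : Digraph) → (Vertex F → Bool) → Digraph
addSource F out = record { size = suc (size F) ; arc = arcs ; loopless = noLoop }
  where
  arcs : Fin (suc (size F)) → Fin (suc (size F)) → Bool
  arcs zero zero = false
  arcs zero (suc v) = out v
  arcs (suc _) zero = false
  arcs (suc u) (suc v) = arc F u v
  noLoop : ∀ v → arcs v v ≡ false
  noLoop zero = refl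
  noLoop (suc v) = loopless F v

record Fan (D : Digraph) (X : Pred (Vertex D) 0ℓ) {n : ℕ} (out : Fin n → Bool)
           (target : Fin n → Vertex D) : Set where
  field
    centre : Vertex D
    centre∉ : ¬ X centre
    spoke : ∀ y → out y ≡ true → Path D centre (target y)
    spoke-len : ∀ y o → 1 ≤ len (spoke y o)
    spoke-avoids : ∀ y o {x} → Interior (spoke y o) x → ¬ X x
    spoke-disjoint : ∀ y o y′ o′ {x} → Interior (spoke y o) x → Interior (spoke y′ o′) x → y ≡ y′

extendBySource : ∀ {D F X out} (σ : SubdivisionIn D F X) →
                 Fan D X out (CS.branch (SubdivisionIn.subdivision σ)) → ContainsSubdivision D (addSource F out)
extendBySource {D} {F} {X} {out} σ fan = record
  { branch = br ; branch-inj = br-injective ; path = pth ; path-len = pth-len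
  ; avoid-branch = avoid ; int-disjoint = disjoint }
  where
  open SubdivisionIn σ
  open Fan fan
  G : Digraph
  G = addSource F out

  br : Vertex G → Vertex D
  br zero = centre
  br (suc z) = CS.branch subdivision z

  br-injective : Injective _≡_ _≡_ br
  br-injective {zero} {zero} _ = refl
  br-injective {zero} {suc z} eq = ⊥-elim (centre∉ (subst X (sym eq) (branch-in z)))
  br-injective {suc z} {zero} eq = ⊥-elim (centre∉ (subst X eq (branch-in z)))
  br-injective {suc _} {suc _} eq = cong suc (CS.branch-inj subdivision eq)

  pth : ∀ u v → Arc G u v → Path D (br u) (br v)
  pth zero (suc v) a = spoke v a
  pth (suc u) (suc v) a = CS.path subdivision u v a

  pth-len : ∀ u v (a : Arc G u v) → 1 ≤ len (pth u v a)
  pth-len zero (suc v) a = spoke-len v a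
  pth-len (suc u) (suc v) a = CS.path-len subdivision u v a

  interior-in : ∀ {u v} (a : Arc F u v) {x} → Interior (CS.path subdivision u v a) x → X x
  interior-in a (i , _ , _ , refl) = path-in _ _ a i

  avoid : ∀ u v (a : Arc G u v) x → Interior (pth u v a) x → ∀ z → br z ≢ x
  avoid zero (suc v) a x int zero eq = interior≢start (spoke v a) int (sym eq)
  avoid zero (suc v) a x int (suc z) eq = spoke-avoids v a int (subst X eq (branch-in z))
  avoid (suc u) (suc v) a x int zero eq = centre∉ (subst X (sym eq) (interior-in a int))
  avoid (suc u) (suc v) a x int (suc z) eq = CS.avoid-branch subdivision u v a x int z eq

  disjoint : ∀ u v (a : Arc G u v) u′ v′ (a′ : Arc G u′ v′) x →
             Interior (pth u v a) x → Interior (pth u′ v′ a′) x → (u ≡ u′) × (v ≡ v′)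
  disjoint zero (suc v) a zero (suc v′) a′ x int int′ =
    refl , cong suc (spoke-disjoint v a v′ a′ int int′)
  disjoint zero (suc v) a (suc u′) (suc v′) a′ x int int′ =
    ⊥-elim (spoke-avoids v a int (interior-in a′ int′))
  disjoint (suc u) (suc v) a zero (suc v′) a′ x int int′ =
    ⊥-elim (spoke-avoids v′ a′ int′ (interior-in a int))
  disjoint (suc u) (suc v) a (suc u′) (suc v′) a′ x int int′ =
    let (u≡u′ , v≡v′) = CS.int-disjoint subdivision u v a u′ v′ a′ x int int′
    in cong suc u≡u′ , cong suc v≡v′

containsSubdivision-subgraph : ∀ {D F G} (φ : Vertex F → Vertex G) → Injective _≡_ _≡_ φ →
                               (∀ {u v} → Arc F u v → Arc G (φ u) (φ v)) →
                               ContainsSubdivision D G → ContainsSubdivision D F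
containsSubdivision-subgraph φ φ-injective φ-arc σ = record
  { branch = CS.branch σ ∘ φ
  ; branch-inj = φ-injective ∘ CS.branch-inj σ
  ; path = λ u v a → CS.path σ (φ u) (φ v) (φ-arc a)
  ; path-len = λ u v a → CS.path-len σ (φ u) (φ v) (φ-arc a)
  ; avoid-branch = λ u v a x int z → CS.avoid-branch σ (φ u) (φ v) (φ-arc a) x int (φ z)
  ; int-disjoint = λ u v a u′ v′ a′ x int int′ →
      let (eq , eq′) = CS.int-disjoint σ (φ u) (φ v) (φ-arc a) (φ u′) (φ v′) (φ-arc a′) x int int′
      in φ-injective eq , φ-injective eq′
  }

sourceOut : (F : Digraph) (x : Vertex F) → Vertex (F − x) → Bool
sourceOut record { size = suc _ ; arc = a } x v = a x (punchIn x v)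

containsSubdivision-addSource : (F : Digraph) (x : Vertex F) → (∀ v → arc F v x ≡ false) →
                                ∀ {D} → ContainsSubdivision D (addSource (F − x) (sourceOut F x)) →
                                ContainsSubdivision D F
containsSubdivision-addSource F@record { size = suc _ ; loopless = noLoop } x source =
  containsSubdivision-subgraph φ φ-injective φ-arc
  where
  G : Digraph
  G = addSource (F − x) (sourceOut F x)
  φ : Vertex F → Vertex G
  φ v with v Fin.≟ x
  ... | yes _ = zero
  ... | no v≢x = suc (punchOut (v≢x ∘ sym))
  φ-injective : Injective _≡_ _≡_ φ
  φ-injective {v} {w} eq with v Fin.≟ x | w Fin.≟ x
  ... | yes refl | yes refl = refl
  ... | no v≢x | no w≢x = Finₚ.punchOut-injective (v≢x ∘ sym) (w≢x ∘ sym) (Finₚ.suc-injective eq)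
  φ-arc : ∀ {u v} → Arc F u v → Arc G (φ u) (φ v)
  φ-arc {u} {v} uv with u Fin.≟ x | v Fin.≟ x
  ... | yes refl | yes refl = ⊥-elim (true≢false (trans (sym uv) (noLoop x)))
  ... | yes refl | no _ = subst (Arc F x) (sym (Finₚ.punchIn-punchOut _)) uv
  ... | no _ | yes refl = ⊥-elim (true≢false (trans (sym uv) (source u)))
  ... | no _ | no _ = subst₂ (Arc F) (sym (Finₚ.punchIn-punchOut _)) (sym (Finₚ.punchIn-punchOut _)) uv

three≤∣p∣ : ∀ {n} (p : Subset n) {a b c} → a Subset.∈ p → b Subset.∈ p → c Subset.∈ p →
            a ≢ b → a ≢ c → b ≢ c → 3 ≤ ∣ p ∣
three≤∣p∣ p {a} {b} {c} a∈ b∈ c∈ a≢b a≢c b≢c =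
  ≤-trans (s≤s (≤-trans (s≤s nonempty) (x∈p⇒∣p-x∣<∣p∣ b∈p-a))) (x∈p⇒∣p-x∣<∣p∣ a∈)
  where
  b∈p-a : b Subset.∈ p - a
  b∈p-a = x∈p∧x≢y⇒x∈p-y b∈ (a≢b ∘ sym)
  c∈p-a-b : c Subset.∈ p - a - b
  c∈p-a-b = x∈p∧x≢y⇒x∈p-y (x∈p∧x≢y⇒x∈p-y c∈ (a≢c ∘ sym)) (b≢c ∘ sym)
  nonempty : 0 < ∣ p - a - b ∣
  nonempty = ≤-<-trans z≤n (x∈p⇒∣p-x∣<∣p∣ c∈p-a-b)

coverByTwo : ∀ {n} {P : Pred (Fin n) 0ℓ} → Decidable P →
             (∀ {a b c} → P a → P b → P c → a ≢ b → a ≢ c → b ≢ c → ⊥) →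
             Fin n → ∃ λ y₁ → ∃ λ y₂ → ∀ {v} → P v → v ≡ y₁ ⊎ v ≡ y₂
coverByTwo {P = P} P? noThree d with any? P?
... | no none = d , d , λ pv → ⊥-elim (none (_ , pv))
... | yes (y₁ , p₁) with any? (λ v → P? v ×-dec ¬? (v Fin.≟ y₁))
...   | no none = y₁ , y₁ , λ pv → inj₁ (onlyOne pv)
  where
  onlyOne : ∀ {v} → P v → v ≡ y₁
  onlyOne {v} pv with v Fin.≟ y₁
  ... | yes eq = eq
  ... | no v≢y₁ = ⊥-elim (none (v , pv , v≢y₁))
...   | yes (y₂ , p₂ , y₂≢y₁) = y₁ , y₂ , twoOnly
  where
  twoOnly : ∀ {v} → P v → v ≡ y₁ ⊎ v ≡ y₂
  twoOnly {v} pv with v Fin.≟ y₁ | v Fin.≟ y₂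
  ... | yes eq | _ = inj₁ eq
  ... | no _ | yes eq = inj₂ eq
  ... | no v≢y₁ | no v≢y₂ = ⊥-elim (noThree pv p₁ p₂ v≢y₁ v≢y₂ (y₂≢y₁ ∘ sym))

sourceOut-cover : (F : Digraph) (x : Vertex F) → TwoSource F x → Vertex (F − x) →
                  ∃ λ y₁ → ∃ λ y₂ → ∀ {v} → sourceOut F x v ≡ true → v ≡ y₁ ⊎ v ≡ y₂
sourceOut-cover record { size = suc _ ; arc = a } x (_ , outdeg) =
  coverByTwo (λ v → a x (punchIn x v) Bool.≟ true) λ pa pb pc a≢b a≢c b≢c →
    <⇒≱ (n<1+n 2) (≤-trans (three≤∣p∣ (tabulate (a x)) (∈out pa) (∈out pb) (∈out pc)
                                       (a≢b ∘ punchIn-inj) (a≢c ∘ punchIn-inj) (b≢c ∘ punchIn-inj))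
                           outdeg)
  where
  ∈out : ∀ {v} → a x v ≡ true → v Subset.∈ tabulate (a x)
  ∈out {v} axv = lookup⇒[]= v (tabulate (a x)) (trans (lookup∘tabulate (a x) v) axv)
  punchIn-inj : ∀ {v w} → punchIn x v ≡ punchIn x w → v ≡ w
  punchIn-inj = Finₚ.punchIn-injective x _ _

emptyDigraph-madBound : ∀ {F} → ¬ Vertex F → MadBound F 0
emptyDigraph-madBound ¬v D _ = record
  { branch = ⊥-elim ∘ ¬v ; branch-inj = λ {u} → ⊥-elim (¬v u) ; path = λ u → ⊥-elim (¬v u)
  ; path-len = λ u → ⊥-elim (¬v u) ; avoid-branch = λ u → ⊥-elim (¬v u)
  ; int-disjoint = λ u → ⊥-elim (¬v u) }

positiveMad⇒vertex : ∀ {F m} → IsMad F m → 0 < m → Vertex F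
positiveMad⇒vertex {record { size = zero }} (_ , minimal) 0<m =
  ⊥-elim (<⇒≱ 0<m (minimal 0 (emptyDigraph-madBound λ ())))
positiveMad⇒vertex {record { size = suc _ }} _ _ = zero

module SourceExtension {D F : Digraph} {out : Vertex F → Bool} {y₁ y₂ : Vertex F}
  (cover : ∀ {y} → out y ≡ true → y ≡ y₁ ⊎ y ≡ y₂) {k : ℕ}
  (madBound : MadBound F (suc (suc k))) where

  Outcome : Pred (Vertex D) 0ℓ → Set
  Outcome S = SetColouring D S (suc k + suc k) ⊎ ContainsSubdivision D (addSource F out)

  module FromRoot {S : Pred (Vertex D) 0ℓ} (S? : Decidable S) (root : Vertex D) (S-root : S root) where
    open BreadthFirst {D} S? root S-root public

    module AboveRoot (i : ℕ) where
      open Enumeration {D} (layer? (suc i))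

      subdivision-from-uncolourable : ¬ AcyclicColouring (Induced D element) (suc k) →
                                      ContainsSubdivision D (addSource F out)
      subdivision-from-uncolourable ¬col = extendBySource σ fan
        where
        σ : SubdivisionIn D F (Layer (suc i))
        σ = subdivisionFromInduced (madBound _ (¬colourable⇒dichromaticAtLeast ¬col))
        open SubdivisionIn σ
        b : Vertex F → Vertex D
        b = CS.branch subdivision
        open CommonAncestor (proj₁ (branch-in y₁)) (proj₁ (branch-in y₂))
                            (proj₂ (branch-in y₁)) (proj₂ (branch-in y₂))
        side : ∀ {y} → out y ≡ true → OneOf (b y)
        side o = ⊎-map (cong b) (cong b) (cover o)
        fan : Fan D (Layer (suc i)) out b
        fan = record
          { centre = meet
          ; centre∉ = λ (_ , l) → <⇒≢ meet-level l
          ; spoke = λ y o → pathTo (side o)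
          ; spoke-len = λ _ _ → s≤s z≤n
          ; spoke-avoids = λ y o int (_ , l) → <⇒≢ (pathTo-interior-level (side o) int) l
          ; spoke-disjoint = λ y o y′ o′ int int′ →
              CS.branch-inj subdivision (pathTo-disjoint (side o) (side o′) int int′)
          }

      outcome : SetColouring D (Layer (suc i)) (suc k) ⊎ ContainsSubdivision D (addSource F out)
      outcome = ⊎-map colouringFromInduced subdivision-from-uncolourable
                      (toSum (acyclicColouring? {Induced D element} (suc k)))

    layer-outcome : ∀ ℓ → SetColouring D (Layer ℓ) (suc k) ⊎ ContainsSubdivision D (addSource F out)
    layer-outcome zero = inj₁ (atMostOne-colouring {D} {Layer zero}
      λ (r , l) (r′ , l′) → trans (level-zero r l) (sym (level-zero r′ l′)))
    layer-outcome (suc i) = AboveRoot.outcome i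

    extend : Outcome (λ v → S v × ¬ Reached v) → Outcome S
    extend (inj₂ σ) = inj₂ σ
    extend (inj₁ colU) with collectBelow layer-outcome (size D)
    ... | inj₂ σ = inj₂ σ
    ... | inj₁ below = inj₁ (colouring-closedUnion {D} reached? closed colR colU)
      where
      layers : ∀ ℓ → SetColouring D (Layer ℓ) (suc k)
      layers ℓ with ℓ <? size D
      ... | yes ℓ< = below ℓ ℓ<
      ... | no ℓ≮ = atMostOne-colouring {D} {Layer ℓ}
        λ (r , l) → ⊥-elim (ℓ≮ (subst (_< size D) l (level<size r)))
      colR : SetColouring D Reached (suc k + suc k)
      colR = layeredColouring {D} level (λ r r′ a → level-arc r (Within⊆S r′) a) layers

  -- Every vertex of S is a root still to be processed; each processed root leaves S, either because
  -- it is not in S or because it is removed together with everything it reaches.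
  colour-or-subdivide : (roots : List (Vertex D)) {S : Pred (Vertex D) 0ℓ} → Decidable S →
                        (∀ {v} → S v → v ∈ roots) → Outcome S
  colour-or-subdivide [] {S} S? ⊆[] = inj₁ (atMostOne-colouring {D} {S} λ s _ → ⊥-elim (¬Any[] (⊆[] s)))
  colour-or-subdivide (r ∷ rs) S? ⊆roots with S? r
  ... | no ¬Sr = colour-or-subdivide rs S? λ s → ∈-tail (λ { refl → ¬Sr s }) (⊆roots s)
  ... | yes Sr = extend (colour-or-subdivide rs (λ v → S? v ×-dec ¬? (reached? v))
                          λ (s , ¬r) → ∈-tail (λ { refl → ¬r root-reached }) (⊆roots s))
    where open FromRoot S? r Sr

colours-needed : ∀ k → 2 * suc (suc k) ∸ 1 ≡ suc (suc k + suc k)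
colours-needed k = cong suc (trans (+-suc k (suc (k + 0))) (cong (λ n → suc (k + suc n)) (+-identityʳ k)))

lemma37 : (F : Digraph) (x : Vertex F) → TwoSource F x →
          (m : ℕ) → IsMad (F − x) m → 2 ≤ m →
          MadBound F (2 * m ∸ 1)
lemma37 F x _ (suc zero) _ (s≤s ())
lemma37 F x twoSource@(source , _) (suc (suc k)) mad@(madBound , _) _ D χ≥
  with sourceOut-cover F x twoSource (positiveMad⇒vertex mad (s≤s z≤n))
... | _ , _ , cover = [ uncolourable , containsSubdivision-addSource F x source ]′
  (SourceExtension.colour-or-subdivide cover madBound (allFin (size D)) (λ _ → yes tt) (λ _ → ∈-allFin _))
  where
  uncolourable : SetColouring D (λ _ → ⊤) (suc k + suc k) → ContainsSubdivision D F
  uncolourable col = ⊥-elim (1+n≰n (subst (_≤ suc k + suc k) (colours-needed k)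
                                           (χ≥ _ (SetColouring⊤⇒AcyclicColouring col))))
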